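{- Let $\rho=l\to r$ be a linear term rewrite rule over a signature $\Sigma$ and $G$ a finite $\Sigma^\circ$-labeled graph. If $m:l^\circ\rightarrowtail G$ is the match morphism of a PBPO$^+$ rewrite step via $\rho^\circ$ (i.e., there is $\alpha:G\to\mathcal{C}[l^\circ{\downarrow_\mathcal{X}}]$ with $\alpha\circ m=t_L$ such that $l^\circ$ with $1_{l^\circ}$ and $m$ is a pullback of $t_L$ and $\alpha$), then $m$ maps every symbol vertex of $l^\circ$ onto a good vertex of $G$.
   Context: Terms over $\Sigma$ (arities $\#$) and variables $\mathcal{X}$; linear = each variable at most once; rule $l\to r$ with $l\notin\mathcal{X}$, $\mathrm{Var}(r)\subseteq\mathrm{Var}(l)$, linear if $l,r$ linear. Graphs have vertex/edge labels in the flat lattice $\Sigma^\circ=(\Sigma\uplus\mathbb{N}^+)\uplus\{\bot,\top\}$ ($\bot$ least, $\top$ greatest, others incomparable); morphisms are vertex/edge maps commuting with source/target with $\ell(x)\le\ell(\phi(x))$. For linear $t$, $t^\circ$ has a vertex $p$ labeled $f$ for each position $p$ of $t$ holding a function symbol $f$ (symbol vertices), a vertex $x$ labeled $\bot$ for each variable $x$ of $t$ (variable heads), and for each position $p$ holding a symbol of arity $n$ and $1\le i\le n$ an edge labeled $i$ from the vertex at $p$ to that at $pi$; root at $\epsilon$. $\mathcal{C}[l^\circ{\downarrow_\mathcal{X}}]$ is obtained from $l^\circ$ by relabeling each variable vertex $x$ to $\top$ and adding a fresh $\top$-vertex $x'$ with $\top$-edges $x\to x'$, $x'\to x'$, and adding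 a fresh $\top$-vertex $\mathcal{C}$ with $\top$-edges $\mathcal{C}\to$ root and $\mathcal{C}\to\mathcal{C}$; $t_L$ is the inclusion $l^\circ\rightarrowtail\mathcal{C}[l^\circ{\downarrow_\mathcal{X}}]$. (The rule $\rho^\circ$ has left pattern $L=l^\circ$, type graph $L'=\mathcal{C}[l^\circ{\downarrow_\mathcal{X}}]$ and typing $t_L$.) A vertex $v$ of $G$ is in-well-formed (I) if it has at most one incoming edge; out-well-formed (O) if its label $l$ lies in $\Sigma$ and $v$ has precisely $\#(l)$ outgoing edges, labeled $1,\ldots,\#(l)$; good if it is O and all its children are I. -}

module Defs where

open import Data.Nat using (ℕ; zero; suc)
open import Data.Fin using (Fin; toℕ)
open import Data.Product using (Σ; _×_; _,_; proj₁)
open import Data.Unit using (⊤; tt)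
open import Data.Empty using (⊥)
open import Function.Bundles using (_↔_)
open import Function.Definitions using (Injective)
open import Relation.Binary.PropositionalEquality using (_≡_; refl)

record Signature : Set₁ where
  field
    Sym : Set
    ar  : Sym → ℕ

module Sig (S : Signature) where
  open Signature S

  data Term (X : Set) : Set where
    var : X → Term X
    fun : (f : Sym) → (Fin (ar f) → Term X) → Term X

  data Pos {X : Set} : Term X → Set where
    here  : ∀ {t} → Pos t
    child : ∀ {f ts} (i : Fin (ar f)) → Pos (ts i) → Pos (fun f ts)

  at : ∀ {X} (t : Term X) → Pos t → Term X
  at t here = t
  at (fun f ts) (child i p) = at (ts i) p

  IsVar : ∀ {X} → Term X → Set
  IsVar (var _)   = ⊤
  IsVar (fun _ _) = ⊥

  IsFun : ∀ {X} → Term X → Set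
  IsFun (var _)   = ⊥
  IsFun (fun _ _) = ⊤

  _∈Var_ : ∀ {X} → X → Term X → Set
  x ∈Var t = Σ (Pos t) λ p → at t p ≡ var x

  Linear : ∀ {X} → Term X → Set
  Linear t = ∀ (p q : Pos t) x → at t p ≡ var x → at t q ≡ var x → p ≡ q

  record Rule (X : Set) : Set where
    field
      lhs       : Term X
      rhs       : Term X
      lhs-nonvar : IsFun lhs
      var-incl  : ∀ x → x ∈Var rhs → x ∈Var lhs

  LinearRule : ∀ {X} → Rule X → Set
  LinearRule ρ = Linear (Rule.lhs ρ) × Linear (Rule.rhs ρ)

  -- The flat lattice Σ° = (Σ ⊎ ℕ⁺) ⊎ {⊥, ⊤}
  -- NOTE: num k denotes the positive natural number k+1.
  data Lab : Set where
    sym : Sym → Lab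
    num : ℕ → Lab
    bot : Lab
    top : Lab

  data _⊑_ : Lab → Lab → Set where
    ⊑-refl : ∀ {a} → a ⊑ a
    bot⊑   : ∀ {a} → bot ⊑ a
    ⊑top   : ∀ {a} → a ⊑ top

  record Graph : Set₁ where
    field
      V    : Set
      E    : Set
      src  : E → V
      tgt  : E → V
      vlab : V → Lab
      elab : E → Lab

  open Graph

  FiniteGraph : Graph → Set
  FiniteGraph G = (Σ ℕ λ n → V G ↔ Fin n) × (Σ ℕ λ n → E G ↔ Fin n)

  record Hom (G H : Graph) : Set where
    field
      vmap     : V G → V H
      emap     : E G → E H
      src-comm : ∀ e → vmap (src G e) ≡ src H (emap e)
      tgt-comm : ∀ e → vmap (tgt G e) ≡ tgt H (emap e)
      vlab-le  : ∀ v → vlab G v ⊑ vlab H (vmap v)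
      elab-le  : ∀ e → elab G e ⊑ elab H (emap e)
  open Hom

  idH : ∀ {G} → Hom G G
  idH = record { vmap = λ v → v ; emap = λ e → e ; src-comm = λ _ → refl
               ; tgt-comm = λ _ → refl ; vlab-le = λ _ → ⊑-refl ; elab-le = λ _ → ⊑-refl }

  ⊑-trans : ∀ {a b c} → a ⊑ b → b ⊑ c → a ⊑ c
  ⊑-trans ⊑-refl q = q
  ⊑-trans bot⊑ q = bot⊑
  ⊑-trans ⊑top ⊑-refl = ⊑top
  ⊑-trans ⊑top ⊑top = ⊑top

  trans≡ : ∀ {A : Set} {a b c : A} → a ≡ b → b ≡ c → a ≡ c
  trans≡ refl q = q

  cong≡ : ∀ {A B : Set} (f : A → B) {a b : A} → a ≡ b → f a ≡ f b
  cong≡ f refl = refl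

  _∘H_ : ∀ {G H K} → Hom H K → Hom G H → Hom G K
  g ∘H f = record
    { vmap = λ v → vmap g (vmap f v)
    ; emap = λ e → emap g (emap f e)
    ; src-comm = λ e → trans≡ (cong≡ (vmap g) (src-comm f e)) (src-comm g (emap f e))
    ; tgt-comm = λ e → trans≡ (cong≡ (vmap g) (tgt-comm f e)) (tgt-comm g (emap f e))
    ; vlab-le = λ v → ⊑-trans (vlab-le f v) (vlab-le g (vmap f v))
    ; elab-le = λ e → ⊑-trans (elab-le f e) (elab-le g (emap f e)) }

  _≈H_ : ∀ {G H} → Hom G H → Hom G H → Set
  f ≈H g = (∀ v → vmap f v ≡ vmap g v) × (∀ e → emap f e ≡ emap g e)

  Mono : ∀ {G H} → Hom G H → Set
  Mono f = Injective _≡_ _≡_ (vmap f) × Injective _≡_ _≡_ (emap f)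

  record IsPullback {P A B C : Graph} (p₁ : Hom P A) (p₂ : Hom P B)
                    (f : Hom A C) (g : Hom B C) : Set₁ where
    field
      commutes  : (f ∘H p₁) ≈H (g ∘H p₂)
      universal : ∀ (Q : Graph) (q₁ : Hom Q A) (q₂ : Hom Q B) →
                  (f ∘H q₁) ≈H (g ∘H q₂) →
                  Σ (Hom Q P) λ u → ((p₁ ∘H u) ≈H q₁) × ((p₂ ∘H u) ≈H q₂)
      unique    : ∀ (Q : Graph) (q₁ : Hom Q A) (q₂ : Hom Q B) →
                  (f ∘H q₁) ≈H (g ∘H q₂) → (u u' : Hom Q P) →
                  ((p₁ ∘H u) ≈H q₁) → ((p₂ ∘H u) ≈H q₂) →
                  ((p₁ ∘H u') ≈H q₁) → ((p₂ ∘H u') ≈H q₂) → u ≈H u'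

  -- The term graph t° (for linear t): one vertex per position
  -- (symbol vertices labeled f, variable heads labeled ⊥), and an edge
  -- labeled i from p to p·i.
  data EPos {X : Set} : Term X → Set where
    eHere  : ∀ {f ts} (i : Fin (ar f)) → EPos (fun f ts)
    eChild : ∀ {f ts} (i : Fin (ar f)) → EPos (ts i) → EPos (fun f ts)

  esrc : ∀ {X} {t : Term X} → EPos t → Pos t
  esrc (eHere i)    = here
  esrc (eChild i e) = child i (esrc e)

  etgt : ∀ {X} {t : Term X} → EPos t → Pos t
  etgt (eHere i)    = child i here
  etgt (eChild i e) = child i (etgt e)

  -- 0-based child index of the edge; the edge label is num (eidx e), i.e. eidx e + 1
  eidx : ∀ {X} {t : Term X} → EPos t → ℕ
  eidx (eHere i)    = toℕ i
  eidx (eChild i e) = eidx e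

  termLab : ∀ {X} → Term X → Lab
  termLab (var _)   = bot
  termLab (fun f _) = sym f

  _° : ∀ {X} → Term X → Graph
  t ° = record { V = Pos t ; E = EPos t ; src = esrc ; tgt = etgt
               ; vlab = λ p → termLab (at t p) ; elab = λ e → num (eidx e) }

  VarPos : ∀ {X} → Term X → Set
  VarPos t = Σ (Pos t) λ p → IsVar (at t p)

  data CtxV {X : Set} (t : Term X) : Set where
    old   : Pos t → CtxV t
    prime : VarPos t → CtxV t
    cvert : CtxV t

  data CtxE {X : Set} (t : Term X) : Set where
    old       : EPos t → CtxE t
    toPrime   : VarPos t → CtxE t
    primeLoop : VarPos t → CtxE t
    toRoot    : CtxE t
    cLoop     : CtxE t

  ctxSrc : ∀ {X} {t : Term X} → CtxE t → CtxV t
  ctxSrc (old e)       = old (esrc e)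
  ctxSrc (toPrime v)   = old (proj₁ v)
  ctxSrc (primeLoop v) = prime v
  ctxSrc toRoot        = cvert
  ctxSrc cLoop         = cvert

  ctxTgt : ∀ {X} {t : Term X} → CtxE t → CtxV t
  ctxTgt (old e)       = old (etgt e)
  ctxTgt (toPrime v)   = prime v
  ctxTgt (primeLoop v) = prime v
  ctxTgt toRoot        = old here
  ctxTgt cLoop         = cvert

  ctxTermLab : ∀ {X} → Term X → Lab
  ctxTermLab (var _)   = top
  ctxTermLab (fun f _) = sym f

  ctxVLab : ∀ {X} {t : Term X} → CtxV t → Lab
  ctxVLab {t = t} (old p) = ctxTermLab (at t p)
  ctxVLab (prime _) = top
  ctxVLab cvert     = top

  ctxELab : ∀ {X} {t : Term X} → CtxE t → Lab
  ctxELab (old e) = num (eidx e)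
  ctxELab _       = top

  Ctx : ∀ {X} → Term X → Graph
  Ctx t = record { V = CtxV t ; E = CtxE t ; src = ctxSrc ; tgt = ctxTgt
                 ; vlab = ctxVLab ; elab = ctxELab }

  termLab⊑ : ∀ {X} (u : Term X) → termLab u ⊑ ctxTermLab u
  termLab⊑ (var _)   = bot⊑
  termLab⊑ (fun _ _) = ⊑-refl

  tL : ∀ {X} (t : Term X) → Hom (t °) (Ctx t)
  tL t = record { vmap = old ; emap = old ; src-comm = λ _ → refl ; tgt-comm = λ _ → refl
                ; vlab-le = λ p → termLab⊑ (at t p) ; elab-le = λ _ → ⊑-refl }

  InWF : (G : Graph) → V G → Set
  InWF G v = ∀ (e e' : E G) → tgt G e ≡ v → tgt G e' ≡ v → e ≡ e'

  OutWF : (G : Graph) → V G → Set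
  OutWF G v = Σ Sym λ f → (vlab G v ≡ sym f)
    × (∀ (e : E G) → src G e ≡ v → Σ (Fin (ar f)) λ i → elab G e ≡ num (toℕ i))
    × (∀ (i : Fin (ar f)) → Σ (E G) λ e → (src G e ≡ v) × (elab G e ≡ num (toℕ i))
         × (∀ (e' : E G) → src G e' ≡ v → elab G e' ≡ num (toℕ i) → e' ≡ e))

  Good : (G : Graph) → V G → Set
  Good G v = OutWF G v × (∀ (e : E G) → src G e ≡ v → InWF G (tgt G e))

{-# OPTIONS --safe #-}
-- The pullback condition says that G contains no edges over the image of
-- t_L other than those of m, so around a matched symbol vertex G looks
-- exactly like l°; and α ∘ m = t_L squeezes the labels there between those
-- of l° and of the type graph, which agree on symbol vertices and on edges.
-- Goodness of a symbol vertex in the term graph l° therefore transfers to G.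
module Submission where

open import Data.Bool using (Bool; true; false)
open import Data.Empty using (⊥; ⊥-elim)
open import Data.Fin using (Fin; toℕ)
open import Data.Fin.Properties using (toℕ-injective)
open import Data.Product using (Σ; _×_; _,_; proj₁; proj₂)
open import Data.Unit using (⊤; tt)
open import Relation.Binary.PropositionalEquality as ≡ using (_≡_; refl; trans; cong; subst)

open import Defs

module _ (S : Signature) where
  open Signature S
  open Sig S
  open Graph
  open Hom

  ⊑-antisym : ∀ {a b} → a ⊑ b → b ⊑ a → a ≡ b
  ⊑-antisym ⊑-refl _      = refl
  ⊑-antisym bot⊑  ⊑-refl = refl
  ⊑-antisym bot⊑  bot⊑   = refl
  ⊑-antisym ⊑top  ⊑-refl = refl
  ⊑-antisym ⊑top  ⊑top   = refl

  num-injective : ∀ {m n} → num m ≡ num n → m ≡ n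
  num-injective refl = refl

  module _ {A B C : Graph} (m : Hom A B) (g : Hom B C) {f : Hom A C}
           (comm : (g ∘H m) ≈H f) where

    vlab-squeezed : ∀ v → vlab C (vmap f v) ≡ vlab A v → vlab B (vmap m v) ≡ vlab A v
    vlab-squeezed v f-exact = ⊑-antisym
      (subst (vlab B (vmap m v) ⊑_) (trans (cong (vlab C) (proj₁ comm v)) f-exact)
             (vlab-le g (vmap m v)))
      (vlab-le m v)

    elab-squeezed : ∀ a → elab C (emap f a) ≡ elab A a → elab B (emap m a) ≡ elab A a
    elab-squeezed a f-exact = ⊑-antisym
      (subst (elab B (emap m a) ⊑_) (trans (cong (elab C) (proj₂ comm a)) f-exact)
             (elab-le g (emap m a)))
      (elab-le m a)

  OutSurjective : ∀ {A B} → Hom A B → V A → Set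
  OutSurjective {A} {B} f v =
    ∀ e → src B e ≡ vmap f v → Σ (E A) λ a → (e ≡ emap f a) × (src A a ≡ v)

  InSurjective : ∀ {A B} → Hom A B → V A → Set
  InSurjective {A} {B} f w =
    ∀ e → tgt B e ≡ vmap f w → Σ (E A) λ a → (e ≡ emap f a) × (tgt A a ≡ w)

  Good-transport : ∀ {A B} (f : Hom A B) {v} →
    vlab B (vmap f v) ≡ vlab A v → (∀ a → elab B (emap f a) ≡ elab A a) →
    OutSurjective f v → (∀ a → src A a ≡ v → InSurjective f (tgt A a)) →
    Good A v → Good B (vmap f v)
  Good-transport {A} {B} f {v} vlab≡ elab≡ out-surj in-surj ((s , lab , outs , ins) , kids) =
    (s , trans vlab≡ lab , outs′ , ins′) , kids′
    where
      outs′ : ∀ e → src B e ≡ vmap f v → Σ (Fin (ar s)) λ i → elab B e ≡ num (toℕ i)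
      outs′ e e-src with out-surj e e-src
      ... | a , refl , a-src with outs a a-src
      ...   | i , a-lab = i , trans (elab≡ a) a-lab

      ins′ : ∀ i → Σ (E B) λ e → (src B e ≡ vmap f v) × (elab B e ≡ num (toℕ i))
               × (∀ e′ → src B e′ ≡ vmap f v → elab B e′ ≡ num (toℕ i) → e′ ≡ e)
      ins′ i with ins i
      ... | a , a-src , a-lab , a-unique =
        emap f a , trans (≡.sym (src-comm f a)) (cong (vmap f) a-src)
                 , trans (elab≡ a) a-lab , unique
        where
          unique : ∀ e′ → src B e′ ≡ vmap f v → elab B e′ ≡ num (toℕ i) → e′ ≡ emap f a
          unique e′ e′-src e′-lab with out-surj e′ e′-src
          ... | b , refl , b-src = cong (emap f) (a-unique b b-src (trans (≡.sym (elab≡ b)) e′-lab))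

      kids′ : ∀ e → src B e ≡ vmap f v → InWF B (tgt B e)
      kids′ e e-src with out-surj e e-src
      ... | a , refl , a-src = λ e₁ e₂ e₁-tgt e₂-tgt →
        trans (from-into-tgt e₁ e₁-tgt) (≡.sym (from-into-tgt e₂ e₂-tgt))
        where
          from-into-tgt : ∀ e₁ → tgt B e₁ ≡ tgt B (emap f a) → e₁ ≡ emap f a
          from-into-tgt e₁ e₁-tgt with in-surj a a-src e₁ (trans e₁-tgt (≡.sym (tgt-comm f a)))
          ... | b , refl , b-tgt = cong (emap f) (kids a a-src b a b-tgt refl)

  arrow : Graph
  arrow = record { V = Bool ; E = ⊤ ; src = λ _ → true ; tgt = λ _ → false
                 ; vlab = λ _ → bot ; elab = λ _ → bot }

  -- Test the pullback against the one-edge graph mapped onto a and e.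
  pullback-edge-in-image : ∀ {A G C} {m : Hom A G} {f : Hom A C} {g : Hom G C} →
    IsPullback idH m f g → ∀ e a → emap g e ≡ emap f a → e ≡ emap m a
  pullback-edge-in-image {A} {G} {C} {m} {f} {g} pb e a g-e≡f-a =
    trans (≡.sym (proj₂ m∘u≈q₂ tt)) (cong (emap m) (proj₂ u≈q₁ tt))
    where
      q₁ : Hom arrow A
      q₁ = record { vmap = λ { true → src A a ; false → tgt A a } ; emap = λ _ → a
                  ; src-comm = λ _ → refl ; tgt-comm = λ _ → refl
                  ; vlab-le = λ _ → bot⊑ ; elab-le = λ _ → bot⊑ }
      q₂ : Hom arrow G
      q₂ = record { vmap = λ { true → src G e ; false → tgt G e } ; emap = λ _ → e
                  ; src-comm = λ _ → refl ; tgt-comm = λ _ → refl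
                  ; vlab-le = λ _ → bot⊑ ; elab-le = λ _ → bot⊑ }
      square : (f ∘H q₁) ≈H (g ∘H q₂)
      square =
          (λ { true  → trans (src-comm f a) (trans (cong (src C) (≡.sym g-e≡f-a)) (≡.sym (src-comm g e)))
             ; false → trans (tgt-comm f a) (trans (cong (tgt C) (≡.sym g-e≡f-a)) (≡.sym (tgt-comm g e))) })
        , (λ _ → ≡.sym g-e≡f-a)
      mediator = IsPullback.universal pb arrow q₁ q₂ square
      u≈q₁ = proj₁ (proj₂ mediator)
      m∘u≈q₂ = proj₂ (proj₂ mediator)

  child-injectiveˡ : ∀ {X f} {ts : Fin (ar f) → Term X} {i j} {p : Pos (ts i)} {q : Pos (ts j)} →
    _≡_ {A = Pos (fun f ts)} (child i p) (child j q) → i ≡ j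
  child-injectiveˡ refl = refl

  child-injectiveʳ : ∀ {X f} {ts : Fin (ar f) → Term X} {i} {p q : Pos (ts i)} →
    _≡_ {A = Pos (fun f ts)} (child i p) (child i q) → p ≡ q
  child-injectiveʳ refl = refl

  etgt≢here : ∀ {X} {t : Term X} (a : EPos t) → etgt a ≡ here → ⊥
  etgt≢here (eHere _)    ()
  etgt≢here (eChild _ _) ()

  etgt-injective : ∀ {X} {t : Term X} (a b : EPos t) → etgt a ≡ etgt b → a ≡ b
  etgt-injective (eHere i) (eHere j) eq = cong eHere (child-injectiveˡ eq)
  etgt-injective (eHere i) (eChild j b) eq with child-injectiveˡ eq
  ... | refl = ⊥-elim (etgt≢here b (≡.sym (child-injectiveʳ eq)))
  etgt-injective (eChild i a) (eHere j) eq with child-injectiveˡ eq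
  ... | refl = ⊥-elim (etgt≢here a (child-injectiveʳ eq))
  etgt-injective (eChild i a) (eChild j b) eq with child-injectiveˡ eq
  ... | refl = cong (eChild i) (etgt-injective a b (child-injectiveʳ eq))

  esrc-eidx-injective : ∀ {X} {t : Term X} (a b : EPos t) →
    esrc a ≡ esrc b → eidx a ≡ eidx b → a ≡ b
  esrc-eidx-injective (eHere i)    (eHere j)    _  idx = cong eHere (toℕ-injective idx)
  esrc-eidx-injective (eHere i)    (eChild j b) () _
  esrc-eidx-injective (eChild i a) (eHere j)    () _
  esrc-eidx-injective (eChild i a) (eChild j b) eq idx with child-injectiveˡ eq
  ... | refl = cong (eChild i) (esrc-eidx-injective a b (child-injectiveʳ eq) idx)

  eidx<ar : ∀ {X} {t : Term X} (a : EPos t) {p f ts} →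
    esrc a ≡ p → at t p ≡ fun f ts → Σ (Fin (ar f)) λ i → eidx a ≡ toℕ i
  eidx<ar (eHere i)    refl refl = i , refl
  eidx<ar (eChild i a) refl eq   = eidx<ar a refl eq

  out-edge : ∀ {X} {t : Term X} (p : Pos t) {f ts} → at t p ≡ fun f ts → (i : Fin (ar f)) →
    Σ (EPos t) λ a → (esrc a ≡ p) × (eidx a ≡ toℕ i)
  out-edge here refl i = eHere i , refl , refl
  out-edge (child j q) eq i with out-edge q eq i
  ... | a , a-src , a-idx = eChild j a , cong (child j) a-src , a-idx

  term-graph-InWF : ∀ {X} {t : Term X} (q : Pos t) → InWF (t °) q
  term-graph-InWF _ a b refl b-tgt = etgt-injective a b (≡.sym b-tgt)

  symbol-vertex-good : ∀ {X} (t : Term X) (p : Pos t) → IsFun (at t p) → Good (t °) p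
  symbol-vertex-good t p isFun with at t p in eq
  ... | fun f ts = (f , refl , outs , ins) , λ a _ → term-graph-InWF (etgt a)
    where
      outs : ∀ a → esrc a ≡ p → Σ (Fin (ar f)) λ i → num (eidx a) ≡ num (toℕ i)
      outs a a-src with eidx<ar a a-src eq
      ... | i , a-idx = i , cong num a-idx

      ins : ∀ i → Σ (EPos t) λ a → (esrc a ≡ p) × (num (eidx a) ≡ num (toℕ i))
              × (∀ b → esrc b ≡ p → num (eidx b) ≡ num (toℕ i) → b ≡ a)
      ins i with out-edge p eq i
      ... | a , a-src , a-idx = a , a-src , cong num a-idx , λ b b-src b-lab →
        esrc-eidx-injective b a (trans b-src (≡.sym a-src)) (trans (num-injective b-lab) (≡.sym a-idx))

  IsVar⇒¬IsFun : ∀ {X} (u : Term X) → IsVar u → IsFun u → ⊥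
  IsVar⇒¬IsFun (var _)   _ ()
  IsVar⇒¬IsFun (fun _ _) ()

  old-injective : ∀ {X} {t : Term X} {p q : Pos t} → _≡_ {A = CtxV t} (old p) (old q) → p ≡ q
  old-injective refl = refl

  ctx-out-edge : ∀ {X} {t : Term X} {p} (c : CtxE t) → ctxSrc c ≡ old p → IsFun (at t p) →
    Σ (EPos t) λ a → (c ≡ old a) × (esrc a ≡ p)
  ctx-out-edge (old a) eq _ = a , refl , old-injective eq
  ctx-out-edge (toPrime (q , isVar)) eq isFun with old-injective eq
  ... | refl = ⊥-elim (IsVar⇒¬IsFun _ isVar isFun)
  ctx-out-edge (primeLoop _) () _
  ctx-out-edge toRoot () _
  ctx-out-edge cLoop () _

  ctx-in-edge : ∀ {X} {t : Term X} {a : EPos t} (c : CtxE t) → ctxTgt c ≡ old (etgt a) →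
    Σ (EPos t) λ b → (c ≡ old b) × (etgt b ≡ etgt a)
  ctx-in-edge (old b) eq = b , refl , old-injective eq
  ctx-in-edge {a = a} toRoot eq = ⊥-elim (etgt≢here a (≡.sym (old-injective eq)))
  ctx-in-edge (toPrime _) ()
  ctx-in-edge (primeLoop _) ()
  ctx-in-edge cLoop ()

  ctxTermLab-fun : ∀ {X} (u : Term X) → IsFun u → ctxTermLab u ≡ termLab u
  ctxTermLab-fun (fun _ _) _ = refl

  module _ {X} {t : Term X} {G : Graph} (m : Hom (t °) G) (α : Hom G (Ctx t))
           (comm : (α ∘H m) ≈H tL t) (pb : IsPullback idH m (tL t) α) where

    match-out-surjective : ∀ p → IsFun (at t p) → OutSurjective m p
    match-out-surjective p isFun e e-src with ctx-out-edge (emap α e) α-e-src isFun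
      where
        α-e-src : ctxSrc (emap α e) ≡ old p
        α-e-src = trans (≡.sym (src-comm α e)) (trans (cong (vmap α) e-src) (proj₁ comm p))
    ... | a , α-e≡a , a-src = a , pullback-edge-in-image pb e a α-e≡a , a-src

    match-in-surjective : ∀ a → InSurjective m (etgt a)
    match-in-surjective a e e-tgt with ctx-in-edge {a = a} (emap α e) α-e-tgt
      where
        α-e-tgt : ctxTgt (emap α e) ≡ old (etgt a)
        α-e-tgt = trans (≡.sym (tgt-comm α e)) (trans (cong (vmap α) e-tgt) (proj₁ comm (etgt a)))
    ... | b , α-e≡b , b-tgt = b , pullback-edge-in-image pb e b α-e≡b , b-tgt

    match-symbol-vertex-good : ∀ p → IsFun (at t p) → Good G (vmap m p)
    match-symbol-vertex-good p isFun =
      Good-transport m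
        (vlab-squeezed m α {tL t} comm p (ctxTermLab-fun (at t p) isFun))
        (λ a → elab-squeezed m α {tL t} comm a refl)
        (match-out-surjective p isFun)
        (λ a _ → match-in-surjective a)
        (symbol-vertex-good t p isFun)

lemma59 : (S : Signature) (X : Set) → let open Sig S in
    (ρ : Rule X) → LinearRule ρ →
    (G : Graph) → FiniteGraph G →
    (m : Hom (Rule.lhs ρ °) G) → Mono m →
    (α : Hom G (Ctx (Rule.lhs ρ))) → (α ∘H m) ≈H tL (Rule.lhs ρ) →
    IsPullback idH m (tL (Rule.lhs ρ)) α →
    (p : Pos (Rule.lhs ρ)) → IsFun (at (Rule.lhs ρ) p) →
    Good G (Hom.vmap m p)
lemma59 S X ρ _ G _ m _ α comm pb = match-symbol-vertex-good S m α comm pb
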